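{- Let $q$ be a prime power, let $\mathbf{n}=(n_1,\dots,n_t)$ and $\mathbf{m}=(m_1,\dots,m_t)$ be tuples of positive integers with $m_i\ge n_i$ for all $i$, and let $m'=\min\{m_1,\dots,m_t\}$. Then for every $d$, $$A_q^{SRK}(\mathbf{n},\mathbf{m},d)\ge A_{q^{m'}}(t,d).$$
   Context: The sum-rank-metric space is $\mathbb{F}_q^{\mathbf{n}\times\mathbf{m}}=\mathbb{F}_q^{n_1\times m_1}\times\cdots\times\mathbb{F}_q^{n_t\times m_t}$. For $\mathbf{X}=(X_1,\dots,X_t)$, $\mathrm{srk}(\mathbf{X})=\sum_i\mathrm{rk}(X_i)$, and the sum-rank distance of $\mathbf{X},\mathbf{Y}$ is $\mathrm{srk}(\mathbf{X}-\mathbf{Y})$. $A_q^{SRK}(\mathbf{n},\mathbf{m},d)$ is the maximum size of a code $\mathcal{C}\subseteq\mathbb{F}_q^{\mathbf{n}\times\mathbf{m}}$ whose distinct codewords are pairwise at sum-rank distance at least $d$. $A_{Q}(N,d)$ is the maximum size of a code in $\mathbb{F}_{Q}^N$ with minimum Hamming distance at least $d$. -}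

module Defs where

open import Data.Nat using (ℕ; zero; suc; _≤_) renaming (_+_ to _+ℕ_)
open import Data.Fin using (Fin; zero; suc)
open import Data.Product using (Σ; ∃; _×_; _,_)
open import Relation.Binary.PropositionalEquality using (_≡_; _≢_)
open import Relation.Binary.Definitions using (DecidableEquality)
open import Relation.Nullary using (yes; no)
open import Algebra.Core using (Op₁; Op₂)
open import Algebra.Structures using (IsCommutativeRing)
open import Function.Bundles using (_↔_)

-- A finite field with exactly q elements (q is then necessarily a prime power).
-- Equality is propositional equality.
record FiniteField (q : ℕ) : Set₁ where
  field
    Carrier           : Set
    _+_ _*_           : Op₂ Carrier
    -_                : Op₁ Carrier
    0# 1#             : Carrier
    isCommutativeRing : IsCommutativeRing _≡_ _+_ _*_ -_ 0# 1#
    0≢1               : 0# ≢ 1#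
    inverse           : ∀ x → x ≢ 0# → ∃ λ y → x * y ≡ 1#
    _≟_               : DecidableEquality Carrier
    enumeration       : Fin q ↔ Carrier

sumℕ : ∀ {t} → (Fin t → ℕ) → ℕ
sumℕ {zero}  f = 0
sumℕ {suc t} f = f zero +ℕ sumℕ (λ i → f (suc i))

module _ {q : ℕ} (F : FiniteField q) where
  open FiniteField F

  sumF : ∀ {r} → (Fin r → Carrier) → Carrier
  sumF {zero}  f = 0#
  sumF {suc r} f = f zero + sumF (λ i → f (suc i))

  Matrix : ℕ → ℕ → Set
  Matrix n m = Fin n → Fin m → Carrier

  LinIndep : ∀ {r m} → (Fin r → Fin m → Carrier) → Set
  LinIndep {r} {m} v =
    (c : Fin r → Carrier) → (∀ k → sumF (λ j → c j * v j k) ≡ 0#) → ∀ j → c j ≡ 0#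

  RankAtLeast : ∀ {n m} → Matrix n m → ℕ → Set
  RankAtLeast {n} X r = Σ (Fin r → Fin n) λ f → LinIndep (λ j → X (f j))

  SRKSpace : ∀ {t} → (Fin t → ℕ) → (Fin t → ℕ) → Set
  SRKSpace {t} ns ms = (i : Fin t) → Matrix (ns i) (ms i)

  srkSub : ∀ {t} {ns ms : Fin t → ℕ} → SRKSpace ns ms → SRKSpace ns ms → SRKSpace ns ms
  srkSub X Y i a b = X i a b + (- (Y i a b))

  SrkAtLeast : ∀ {t} {ns ms : Fin t → ℕ} → SRKSpace ns ms → ℕ → Set
  SrkAtLeast {t} X d =
    Σ (Fin t → ℕ) λ r → (∀ i → RankAtLeast (X i) (r i)) × (d ≤ sumℕ r)

  -- there is a code C ⊆ F_q^{n × m} with exactly K (distinct) codewords whose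
  -- distinct codewords are pairwise at sum-rank distance ≥ d
  -- (i.e.  A_q^SRK(n, m, d) ≥ K)
  HasSRKCode : ∀ {t} → (Fin t → ℕ) → (Fin t → ℕ) → ℕ → ℕ → Set
  HasSRKCode ns ms d K =
    Σ (Fin K → SRKSpace ns ms) λ c →
      (∀ i j → (∀ l a b → c i l a b ≡ c j l a b) → i ≡ j) ×
      (∀ i j → i ≢ j → SrkAtLeast (srkSub (c i) (c j)) d)

  hammingDist : ∀ {N} → (Fin N → Carrier) → (Fin N → Carrier) → ℕ
  hammingDist {zero}  x y = 0
  hammingDist {suc N} x y with x zero ≟ y zero
  ... | yes _ = hammingDist (λ i → x (suc i)) (λ i → y (suc i))
  ... | no  _ = suc (hammingDist (λ i → x (suc i)) (λ i → y (suc i)))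

  -- there is a code C ⊆ F^N with exactly K (distinct) codewords and minimum
  -- Hamming distance ≥ d  (i.e.  A_|F|(N, d) ≥ K)
  HasHammingCode : ℕ → ℕ → ℕ → Set
  HasHammingCode N d K =
    Σ (Fin K → Fin N → Carrier) λ c →
      (∀ i j → (∀ l → c i l ≡ c j l) → i ≡ j) ×
      (∀ i j → i ≢ j → d ≤ hammingDist (c i) (c j))

-- Write each symbol of F_{q^m'} as its m' base-q digits, i.e. as a vector of F^m', and pad it
-- with zeros to length m_i; a symbol in coordinate i of a Hamming codeword becomes the
-- n_i × m_i matrix all of whose rows are this vector. The map is injective, so two distinct
-- symbols give matrices whose difference has a nonzero row, hence rank at least 1. A pair of
-- codewords differing in w coordinates is therefore sent to matrix tuples at sum-rank distance
-- at least w. No linearity of the digit map is needed.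
module Submission where

open import Defs
open import Data.Nat using (ℕ; zero; suc; _≤_; _<_; _^_)
open import Data.Nat.Properties using (_<?_)
open import Data.Fin using (Fin; toℕ; fromℕ<; inject≤; funToFin; finToFun; combine)
  renaming (zero to fzero; suc to fsuc)
open import Data.Fin.Properties
  using (toℕ-injective; toℕ-fromℕ<; toℕ<n; toℕ-inject≤; funToFin-finToFin)
open import Data.Product using (∃; _,_)
open import Data.Bool using (if_then_else_)
open import Function using (_∘_; _↔_; Inverse; Injection)
open import Function.Properties.Inverse using (↔⇒↣; ↔-sym)
open import Algebra.Bundles using (CommutativeRing)
import Algebra.Properties.Group as GroupProperties
open import Relation.Nullary using (¬_; yes; no; does; contradiction)
open import Relation.Binary.PropositionalEquality

funToFin-cong : ∀ {m n} {f g : Fin m → Fin n} → f ≗ g → funToFin f ≡ funToFin g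
funToFin-cong {zero}  f≗g = refl
funToFin-cong {suc m} f≗g = cong₂ combine (f≗g fzero) (funToFin-cong (f≗g ∘ fsuc))

finToFun-injective : ∀ {m n} {i j : Fin (m ^ n)} → finToFun {m} {n} i ≗ finToFun j → i ≡ j
finToFun-injective {m} {n} {i} {j} eq = begin
  i                              ≡⟨ funToFin-finToFin {n} {m} i ⟨
  funToFin (finToFun {m} {n} i)  ≡⟨ funToFin-cong eq ⟩
  funToFin (finToFun {m} {n} j)  ≡⟨ funToFin-finToFin {n} {m} j ⟩
  j                              ∎
  where open ≡-Reasoning

module Digits {q m} {A B : Set} (enumA : Fin q ↔ A) (enumB : Fin (q ^ m) ↔ B) where

  digits : B → Fin m → A
  digits x = Inverse.to enumA ∘ finToFun {q} {m} (Inverse.to (↔-sym enumB) x)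

  digits-injective : ∀ {x y} → digits x ≗ digits y → x ≡ y
  digits-injective eq =
    Injection.injective (↔⇒↣ (↔-sym enumB))
      (finToFun-injective {q} {m} (Injection.injective (↔⇒↣ enumA) ∘ eq))

module _ {A : Set} where

  pad : ∀ {m M} → A → (Fin m → A) → Fin M → A
  pad {m} z v b with toℕ b <? m
  ... | yes b<m = v (fromℕ< b<m)
  ... | no  _   = z

  pad-inject≤ : ∀ {m M} (z : A) (v : Fin m → A) (m≤M : m ≤ M) (k : Fin m) →
                pad z v (inject≤ k m≤M) ≡ v k
  pad-inject≤ {m} z v m≤M k with toℕ (inject≤ k m≤M) <? m
  ... | yes k<m = cong v (toℕ-injective (trans (toℕ-fromℕ< k<m) (toℕ-inject≤ k m≤M)))
  ... | no  k≮m = contradiction (subst (_< m) (sym (toℕ-inject≤ k m≤M)) (toℕ<n k)) k≮m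

  pad-injective : ∀ {m M} {z : A} {v w : Fin m → A} → m ≤ M → pad {M = M} z v ≗ pad z w → v ≗ w
  pad-injective {z = z} {v} {w} m≤M eq k = begin
    v k                    ≡⟨ pad-inject≤ z v m≤M k ⟨
    pad z v (inject≤ k _)  ≡⟨ eq (inject≤ k m≤M) ⟩
    pad z w (inject≤ k _)  ≡⟨ pad-inject≤ z w m≤M k ⟩
    w k                    ∎
    where open ≡-Reasoning

module FieldProperties {q} (F : FiniteField q) where
  open FiniteField F

  commutativeRing : CommutativeRing _ _
  commutativeRing = record
    { Carrier = Carrier ; _≈_ = _≡_ ; _+_ = _+_ ; _*_ = _*_ ; -_ = -_ ; 0# = 0# ; 1# = 1#
    ; isCommutativeRing = isCommutativeRing }

  open CommutativeRing commutativeRing using (+-group; *-identityˡ; *-assoc; *-comm; zeroʳ; +-identityʳ)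

  x-y≡0⇒x≡y : ∀ x y → x + (- y) ≡ 0# → x ≡ y
  x-y≡0⇒x≡y = GroupProperties.x∙y⁻¹≈ε⇒x≈y +-group

  *-cancelˡ-≡0 : ∀ c w → c ≢ 0# → c * w ≡ 0# → w ≡ 0#
  *-cancelˡ-≡0 c w c≢0 cw≡0 with inverse c c≢0
  ... | c⁻¹ , cc⁻¹≡1 = begin
    w              ≡⟨ *-identityˡ w ⟨
    1# * w         ≡⟨ cong (_* w) (trans (*-comm c⁻¹ c) cc⁻¹≡1) ⟨
    (c⁻¹ * c) * w  ≡⟨ *-assoc c⁻¹ c w ⟩
    c⁻¹ * (c * w)  ≡⟨ cong (c⁻¹ *_) cw≡0 ⟩
    c⁻¹ * 0#       ≡⟨ zeroʳ c⁻¹ ⟩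
    0#             ∎
    where open ≡-Reasoning

  rank≥0 : ∀ {n m} (X : Matrix F n m) → RankAtLeast F X 0
  rank≥0 X = (λ ()) , λ _ _ ()

  nonzero-row⇒rank≥1 : ∀ {n m} (X : Matrix F n m) (a : Fin n) →
                        ¬ (∀ k → X a k ≡ 0#) → RankAtLeast F X 1
  nonzero-row⇒rank≥1 X a X[a]≢0 = (λ _ → a) , λ { c c·X[a]≡0 fzero → coefficient≡0 c c·X[a]≡0 }
    where
    coefficient≡0 : (c : Fin 1 → Carrier) → (∀ k → (c fzero * X a k) + 0# ≡ 0#) → c fzero ≡ 0#
    coefficient≡0 c c·X[a]≡0 with c fzero ≟ 0#
    ... | yes c≡0 = c≡0
    ... | no  c≢0 = contradiction
      (λ k → *-cancelˡ-≡0 (c fzero) (X a k) c≢0 (trans (sym (+-identityʳ _)) (c·X[a]≡0 k)))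
      X[a]≢0

module HammingProperties {Q} (F : FiniteField Q) where
  open FiniteField F

  disagreement : ∀ {N} (x y : Fin N → Carrier) → Fin N → ℕ
  disagreement x y l = if does (x l ≟ y l) then 0 else 1

  hammingDist≡sumℕ-disagreement : ∀ {N} (x y : Fin N → Carrier) →
                                  hammingDist F x y ≡ sumℕ (disagreement x y)
  hammingDist≡sumℕ-disagreement {zero}  x y = refl
  hammingDist≡sumℕ-disagreement {suc N} x y with x fzero ≟ y fzero
  ... | yes _ = hammingDist≡sumℕ-disagreement (x ∘ fsuc) (y ∘ fsuc)
  ... | no  _ = cong suc (hammingDist≡sumℕ-disagreement (x ∘ fsuc) (y ∘ fsuc))

module SymbolwiseEmbedding
  {q Q} (F : FiniteField q) (F' : FiniteField Q) {t} {ns ms : Fin t → ℕ}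
  (φ : ∀ l → FiniteField.Carrier F' → Matrix F (ns l) (ms l))
  (φ-injective : ∀ l {x y} → (∀ a b → φ l x a b ≡ φ l y a b) → x ≡ y)
  (φ-separates : ∀ l {x y} → x ≢ y →
                 RankAtLeast F (λ a b → FiniteField._+_ F (φ l x a b) (FiniteField.-_ F (φ l y a b))) 1)
  where
  open FiniteField F' using (Carrier; _≟_)
  open HammingProperties F'
  open FieldProperties F using (rank≥0)

  embed : (Fin t → Carrier) → SRKSpace F ns ms
  embed x l = φ l (x l)

  rank≥disagreement : (x y : Fin t → Carrier) (l : Fin t) →
                      RankAtLeast F (srkSub F (embed x) (embed y) l) (disagreement x y l)
  rank≥disagreement x y l with x l ≟ y l
  ... | yes _   = rank≥0 (srkSub F (embed x) (embed y) l)
  ... | no  x≢y = φ-separates l x≢y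

  hammingCode⇒srkCode : ∀ {d K} → HasHammingCode F' t d K → HasSRKCode F ns ms d K
  hammingCode⇒srkCode {d} (c , c-injective , c-separated) =
    embed ∘ c ,
    (λ i j c[i]≡c[j] → c-injective i j (λ l → φ-injective l (c[i]≡c[j] l))) ,
    (λ i j i≢j → disagreement (c i) (c j) , rank≥disagreement (c i) (c j) ,
                 subst (d ≤_) (hammingDist≡sumℕ-disagreement (c i) (c j)) (c-separated i j i≢j))

module PaddedDigits {q m'} (F : FiniteField q) (F' : FiniteField (q ^ m')) where
  open FiniteField F using (_+_; -_; 0#; enumeration)
  open FiniteField F' using (Carrier) renaming (enumeration to enumeration')
  open Digits {m = m'} enumeration enumeration'
  open FieldProperties F using (x-y≡0⇒x≡y; nonzero-row⇒rank≥1)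

  digitMatrix : ∀ {n M} → Carrier → Matrix F n M
  digitMatrix x _ = pad 0# (digits x)

  module _ {n M} (1≤n : 1 ≤ n) (m'≤M : m' ≤ M) where

    digitMatrix-injective : ∀ {x y} → (∀ a b → digitMatrix {n} {M} x a b ≡ digitMatrix y a b) → x ≡ y
    digitMatrix-injective eq = digits-injective (pad-injective m'≤M (eq (fromℕ< 1≤n)))

    digitMatrix-separates : ∀ {x y} → x ≢ y →
      RankAtLeast F (λ a b → digitMatrix {n} {M} x a b + (- digitMatrix y a b)) 1
    digitMatrix-separates x≢y = nonzero-row⇒rank≥1 _ (fromℕ< 1≤n) λ row≡0 →
      x≢y (digitMatrix-injective λ _ b → x-y≡0⇒x≡y _ _ (row≡0 b))

-- Only n_i ≥ 1 (a row to hold the digits) and m' ≤ m_i (room for them) are used.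
corollary3p4 : ∀ {q : ℕ} (F : FiniteField q) (t : ℕ) (ns ms : Fin t → ℕ) →
    (∀ i → 1 ≤ ns i) → (∀ i → 1 ≤ ms i) → (∀ i → ns i ≤ ms i) →
    (m' : ℕ) → (∃ λ i → m' ≡ ms i) → (∀ i → m' ≤ ms i) →
    (F' : FiniteField (q ^ m')) → (d K : ℕ) →
    HasHammingCode F' t d K → HasSRKCode F ns ms d K
corollary3p4 F t ns ms ns≥1 _ _ m' _ m'≤ms F' d K =
  hammingCode⇒srkCode (λ _ → digitMatrix)
    (λ l → digitMatrix-injective (ns≥1 l) (m'≤ms l))
    (λ l → digitMatrix-separates (ns≥1 l) (m'≤ms l))
  where
  open PaddedDigits {m' = m'} F F'
  open SymbolwiseEmbedding F F' {ns = ns} {ms = ms}
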